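{- Let $\mathsf C$ be a rig category and $\mathrm{s}(\mathsf C)$ its strictification. Then $\mathrm{s}(\mathsf C)$ is an $\mathrm{Ob}(\mathsf C)$-sesquistrict rig category; that is, for the functor $H$ from the discrete category $\mathrm{Ob}(\mathsf C)$ to $\mathrm{s}(\mathsf C)$ sending each object $A$ to the one-letter word of one-letter words $A$, the left distributor $\delta^l_{H(A),P,Q}$ of $\mathrm{s}(\mathsf C)$ is an identity morphism for every object $A$ of $\mathsf C$ and all objects $P,Q$ of $\mathrm{s}(\mathsf C)$.
   Context: A rig category is a category with two symmetric monoidal structures $(\otimes,1,\sigma^\otimes)$ and $(\oplus,0,\sigma^\oplus)$ and natural isomorphisms $\delta^l_{X,Y,Z}:X\otimes(Y\oplus Z)\to(X\otimes Y)\oplus(X\otimes Z)$, $\delta^r_{X,Y,Z}:(X\oplus Y)\otimes Z\to(X\otimes Z)\oplus(Y\otimes Z)$, $\lambda^\bullet_X:0\otimes X\to0$, $\rho^\bullet_X:X\otimes0\to0$ satisfying Laplaza's coherence axioms. It is (right) strict if both monoidal structures are strict and $\delta^r,\lambda^\bullet,\rho^\bullet$ are identities. A sesquistrict rig category is a functor $H:\mathsf S\to\mathsf D$ with $\mathsf S$ discrete and $\mathsf D$ a strict rig category such that $\delta^l_{H(A),X,Y}$ is an identity for all $A\in\mathsf S$ and all $X,Y$ (one says $\mathsf D$ is $\mathsf S$-sesquistrict). The strictification $\mathrm{s}(\mathsf C)$: objects are finite words of finite words of objects of $\mathsf C$ (formal non-commutative polynomials $P=\bigoplus_i U_i$, $U_i$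 words of objects); $\pi(P)$ denotes the object of $\mathsf C$ obtained by interpreting $P$ with right bracketing (empty words as $0$ or $1$); $\mathrm{s}(\mathsf C)[P,Q]=\mathsf C[\pi P,\pi Q]$ with composition of $\mathsf C$; $\oplus$ is concatenation of outer words, and $\otimes$ on objects is $(\bigoplus_iU_i)\otimes(\bigoplus_jV_j)=\bigoplus_i\bigoplus_jU_iV_j$; the action of $\oplus,\otimes$ on arrows, the symmetries, and the left distributor are those of $\mathsf C$ conjugated by the canonical structural isomorphisms of $\mathsf C$ (given by the coherence theorem for rig categories); e.g. $\delta^l_{S,P,Q}$ in $\mathrm{s}(\mathsf C)$ is $\sigma^\otimes_{S,P\oplus Q};(\sigma^\otimes_{P,S}\oplus\sigma^\otimes_{Q,S})$ with $\sigma^\otimes_{R,T}$ of $\mathrm{s}(\mathsf C)$ given by $\pi(R\otimes T)\cong\pi R\otimes\pi T\xrightarrow{\sigma^\otimes}\pi T\otimes\pi R\cong\pi(T\otimes R)$. This makes $\mathrm{s}(\mathsf C)$ a strict rig category equivalent to $\mathsf C$. -}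

module Defs where

open import Level using (Level; _⊔_) renaming (suc to lsuc)
open import Relation.Binary using (Rel; IsEquivalence)
open import Relation.Binary.PropositionalEquality using (_≡_; refl; cong; trans; sym)
open import Data.List using (List; []; _∷_; _++_; map; [_])
open import Data.List.Properties using (++-assoc)
open import Data.Product using (Σ)

record Category (o ℓ e : Level) : Set (lsuc (o ⊔ ℓ ⊔ e)) where
  infix  4 _≈_
  infixr 9 _∘_
  field
    Obj       : Set o
    _⇒_       : Obj → Obj → Set ℓ
    _≈_       : ∀ {A B} → Rel (A ⇒ B) e
    id        : ∀ {A} → A ⇒ A
    _∘_       : ∀ {A B C} → B ⇒ C → A ⇒ B → A ⇒ C
    assoc     : ∀ {A B C D} {f : A ⇒ B} {g : B ⇒ C} {h : C ⇒ D} →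
                (h ∘ g) ∘ f ≈ h ∘ (g ∘ f)
    identityˡ : ∀ {A B} {f : A ⇒ B} → id ∘ f ≈ f
    identityʳ : ∀ {A B} {f : A ⇒ B} → f ∘ id ≈ f
    equiv     : ∀ {A B} → IsEquivalence (_≈_ {A} {B})
    ∘-resp-≈  : ∀ {A B C} {f h : B ⇒ C} {g i : A ⇒ B} →
                f ≈ h → g ≈ i → f ∘ g ≈ h ∘ i

module _ {o ℓ e : Level} (C : Category o ℓ e) where
  open Category C

  record Iso (A B : Obj) : Set (ℓ ⊔ e) where
    field
      from : A ⇒ B
      to   : B ⇒ A
      isoˡ : to ∘ from ≈ id
      isoʳ : from ∘ to ≈ id

  record SymmetricMonoidal : Set (o ⊔ ℓ ⊔ e) where
    infixr 10 _⊗₀_ _⊗₁_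
    field
      _⊗₀_         : Obj → Obj → Obj
      _⊗₁_         : ∀ {A B C D} → A ⇒ B → C ⇒ D → (A ⊗₀ C) ⇒ (B ⊗₀ D)
      ⊗-identity   : ∀ {A B} → id {A} ⊗₁ id {B} ≈ id
      ⊗-homo       : ∀ {A B C D E F} {f : A ⇒ B} {g : B ⇒ C} {h : D ⇒ E} {k : E ⇒ F} →
                     (g ∘ f) ⊗₁ (k ∘ h) ≈ (g ⊗₁ k) ∘ (f ⊗₁ h)
      ⊗-resp-≈     : ∀ {A B C D} {f f′ : A ⇒ B} {g g′ : C ⇒ D} →
                     f ≈ f′ → g ≈ g′ → f ⊗₁ g ≈ f′ ⊗₁ g′
      unit         : Obj
      associator   : ∀ {X Y Z} → Iso ((X ⊗₀ Y) ⊗₀ Z) (X ⊗₀ (Y ⊗₀ Z))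
      unitorˡ      : ∀ {X} → Iso (unit ⊗₀ X) X
      unitorʳ      : ∀ {X} → Iso (X ⊗₀ unit) X
      braiding     : ∀ {X Y} → Iso (X ⊗₀ Y) (Y ⊗₀ X)
      assoc-nat    : ∀ {A B C D E F} {f : A ⇒ D} {g : B ⇒ E} {h : C ⇒ F} →
                     Iso.from associator ∘ ((f ⊗₁ g) ⊗₁ h) ≈ (f ⊗₁ (g ⊗₁ h)) ∘ Iso.from associator
      unitorˡ-nat  : ∀ {A B} {f : A ⇒ B} → Iso.from unitorˡ ∘ (id ⊗₁ f) ≈ f ∘ Iso.from unitorˡ
      unitorʳ-nat  : ∀ {A B} {f : A ⇒ B} → Iso.from unitorʳ ∘ (f ⊗₁ id) ≈ f ∘ Iso.from unitorʳ
      braiding-nat : ∀ {A B C D} {f : A ⇒ B} {g : C ⇒ D} →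
                     Iso.from braiding ∘ (f ⊗₁ g) ≈ (g ⊗₁ f) ∘ Iso.from braiding
      pentagon     : ∀ {W X Y Z} →
                     Iso.from (associator {W} {X} {Y ⊗₀ Z}) ∘ Iso.from (associator {W ⊗₀ X} {Y} {Z})
                     ≈ (id ⊗₁ Iso.from (associator {X} {Y} {Z})) ∘ Iso.from (associator {W} {X ⊗₀ Y} {Z})
                       ∘ (Iso.from (associator {W} {X} {Y}) ⊗₁ id)
      triangle     : ∀ {X Y} →
                     (id ⊗₁ Iso.from (unitorˡ {Y})) ∘ Iso.from (associator {X} {unit} {Y})
                     ≈ Iso.from (unitorʳ {X}) ⊗₁ id
      hexagon      : ∀ {X Y Z} →
                     Iso.from (associator {Y} {Z} {X}) ∘ Iso.from (braiding {X} {Y ⊗₀ Z})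
                       ∘ Iso.from (associator {X} {Y} {Z})
                     ≈ (id ⊗₁ Iso.from (braiding {X} {Z})) ∘ Iso.from (associator {Y} {X} {Z})
                       ∘ (Iso.from (braiding {X} {Y}) ⊗₁ id)
      commutative  : ∀ {X Y} → Iso.from (braiding {Y} {X}) ∘ Iso.from (braiding {X} {Y}) ≈ id

record RigCategory (o ℓ e : Level) : Set (lsuc (o ⊔ ℓ ⊔ e)) where
  field
    cat : Category o ℓ e
  open Category cat public
  field
    ⊗M : SymmetricMonoidal cat
    ⊕M : SymmetricMonoidal cat
  open SymmetricMonoidal ⊗M public using (_⊗₀_; _⊗₁_)
    renaming (unit to 𝟙; associator to α⊗; unitorˡ to λ⊗; unitorʳ to ρ⊗; braiding to σ⊗)
  open SymmetricMonoidal ⊕M public using ()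
    renaming (_⊗₀_ to _⊕₀_; _⊗₁_ to _⊕₁_; unit to 𝟘; associator to α⊕;
              unitorˡ to λ⊕; unitorʳ to ρ⊕; braiding to σ⊕)

  α⊗⇒ : ∀ {X Y Z} → ((X ⊗₀ Y) ⊗₀ Z) ⇒ (X ⊗₀ (Y ⊗₀ Z))
  α⊗⇒ = Iso.from α⊗
  λ⊗⇒ : ∀ {X} → (𝟙 ⊗₀ X) ⇒ X
  λ⊗⇒ = Iso.from λ⊗
  ρ⊗⇒ : ∀ {X} → (X ⊗₀ 𝟙) ⇒ X
  ρ⊗⇒ = Iso.from ρ⊗
  σ⊗⇒ : ∀ {X Y} → (X ⊗₀ Y) ⇒ (Y ⊗₀ X)
  σ⊗⇒ = Iso.from σ⊗
  α⊕⇒ : ∀ {X Y Z} → ((X ⊕₀ Y) ⊕₀ Z) ⇒ (X ⊕₀ (Y ⊕₀ Z))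
  α⊕⇒ = Iso.from α⊕
  α⊕⇐ : ∀ {X Y Z} → (X ⊕₀ (Y ⊕₀ Z)) ⇒ ((X ⊕₀ Y) ⊕₀ Z)
  α⊕⇐ = Iso.to α⊕
  λ⊕⇒ : ∀ {X} → (𝟘 ⊕₀ X) ⇒ X
  λ⊕⇒ = Iso.from λ⊕
  ρ⊕⇒ : ∀ {X} → (X ⊕₀ 𝟘) ⇒ X
  ρ⊕⇒ = Iso.from ρ⊕
  σ⊕⇒ : ∀ {X Y} → (X ⊕₀ Y) ⇒ (Y ⊕₀ X)
  σ⊕⇒ = Iso.from σ⊕

  field
    δˡ : ∀ {X Y Z} → Iso cat (X ⊗₀ (Y ⊕₀ Z)) ((X ⊗₀ Y) ⊕₀ (X ⊗₀ Z))
    δʳ : ∀ {X Y Z} → Iso cat ((X ⊕₀ Y) ⊗₀ Z) ((X ⊗₀ Z) ⊕₀ (Y ⊗₀ Z))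
    λ* : ∀ {X} → Iso cat (𝟘 ⊗₀ X) 𝟘
    ρ* : ∀ {X} → Iso cat (X ⊗₀ 𝟘) 𝟘

  δˡ⇒ : ∀ {X Y Z} → (X ⊗₀ (Y ⊕₀ Z)) ⇒ ((X ⊗₀ Y) ⊕₀ (X ⊗₀ Z))
  δˡ⇒ = Iso.from δˡ
  δʳ⇒ : ∀ {X Y Z} → ((X ⊕₀ Y) ⊗₀ Z) ⇒ ((X ⊗₀ Z) ⊕₀ (Y ⊗₀ Z))
  δʳ⇒ = Iso.from δʳ
  λ*⇒ : ∀ {X} → (𝟘 ⊗₀ X) ⇒ 𝟘
  λ*⇒ = Iso.from λ*
  ρ*⇒ : ∀ {X} → (X ⊗₀ 𝟘) ⇒ 𝟘
  ρ*⇒ = Iso.from ρ*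

  interchange : ∀ {W X Y Z} → ((W ⊕₀ X) ⊕₀ (Y ⊕₀ Z)) ⇒ ((W ⊕₀ Y) ⊕₀ (X ⊕₀ Z))
  interchange {W} {X} {Y} {Z} =
    α⊕⇐ {W} {Y} {X ⊕₀ Z} ∘ (id ⊕₁ α⊕⇒ {Y} {X} {Z}) ∘ (id ⊕₁ (σ⊕⇒ {X} {Y} ⊕₁ id))
      ∘ (id ⊕₁ α⊕⇐ {X} {Y} {Z}) ∘ α⊕⇒ {W} {X} {Y ⊕₀ Z}

  field
    δˡ-nat : ∀ {A B C D E F} {f : A ⇒ D} {g : B ⇒ E} {h : C ⇒ F} →
             δˡ⇒ ∘ (f ⊗₁ (g ⊕₁ h)) ≈ ((f ⊗₁ g) ⊕₁ (f ⊗₁ h)) ∘ δˡ⇒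
    δʳ-nat : ∀ {A B C D E F} {f : A ⇒ D} {g : B ⇒ E} {h : C ⇒ F} →
             δʳ⇒ ∘ ((f ⊕₁ g) ⊗₁ h) ≈ ((f ⊗₁ h) ⊕₁ (g ⊗₁ h)) ∘ δʳ⇒
    λ*-nat : ∀ {A B} {f : A ⇒ B} → λ*⇒ ∘ (id {𝟘} ⊗₁ f) ≈ λ*⇒
    ρ*-nat : ∀ {A B} {f : A ⇒ B} → ρ*⇒ ∘ (f ⊗₁ id {𝟘}) ≈ ρ*⇒
    laplaza-I     : ∀ {A B C} →
      δˡ⇒ {A} {C} {B} ∘ (id ⊗₁ σ⊕⇒ {B} {C}) ≈ σ⊕⇒ ∘ δˡ⇒ {A} {B} {C}
    laplaza-II    : ∀ {A B C} →
      δʳ⇒ {B} {A} {C} ∘ (σ⊕⇒ {A} {B} ⊗₁ id {C}) ≈ σ⊕⇒ ∘ δʳ⇒ {A} {B} {C}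
    laplaza-III   : ∀ {A B C} →
      (σ⊗⇒ {A} {C} ⊕₁ σ⊗⇒ {B} {C}) ∘ δʳ⇒ {A} {B} {C} ≈ δˡ⇒ {C} {A} {B} ∘ σ⊗⇒ {A ⊕₀ B} {C}
    laplaza-IV    : ∀ {A B C D} →
      α⊕⇒ ∘ (δˡ⇒ {A} {B} {C} ⊕₁ id) ∘ δˡ⇒ {A} {B ⊕₀ C} {D}
      ≈ (id ⊕₁ δˡ⇒ {A} {C} {D}) ∘ δˡ⇒ {A} {B} {C ⊕₀ D} ∘ (id {A} ⊗₁ α⊕⇒ {B} {C} {D})
    laplaza-V     : ∀ {A B C D} →
      (id ⊕₁ δʳ⇒ {B} {C} {D}) ∘ δʳ⇒ {A} {B ⊕₀ C} {D} ∘ (α⊕⇒ {A} {B} {C} ⊗₁ id {D})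
      ≈ α⊕⇒ ∘ (δʳ⇒ {A} {B} {D} ⊕₁ id) ∘ δʳ⇒ {A ⊕₀ B} {C} {D}
    laplaza-VI    : ∀ {A B C D} →
      δˡ⇒ {A} {B ⊗₀ C} {B ⊗₀ D} ∘ (id {A} ⊗₁ δˡ⇒ {B} {C} {D}) ∘ α⊗⇒ {A} {B} {C ⊕₀ D}
      ≈ (α⊗⇒ ⊕₁ α⊗⇒) ∘ δˡ⇒ {A ⊗₀ B} {C} {D}
    laplaza-VII   : ∀ {A B C D} →
      δˡ⇒ {A} {B ⊗₀ D} {C ⊗₀ D} ∘ (id {A} ⊗₁ δʳ⇒ {B} {C} {D}) ∘ α⊗⇒ {A} {B ⊕₀ C} {D}
      ≈ (α⊗⇒ ⊕₁ α⊗⇒) ∘ δʳ⇒ {A ⊗₀ B} {A ⊗₀ C} {D} ∘ (δˡ⇒ {A} {B} {C} ⊗₁ id {D})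
    laplaza-VIII  : ∀ {A B C D} →
      δʳ⇒ {A} {B} {C ⊗₀ D} ∘ α⊗⇒ {A ⊕₀ B} {C} {D}
      ≈ (α⊗⇒ ⊕₁ α⊗⇒) ∘ δʳ⇒ {A ⊗₀ C} {B ⊗₀ C} {D} ∘ (δʳ⇒ {A} {B} {C} ⊗₁ id {D})
    laplaza-IX    : ∀ {A B C D} →
      interchange ∘ (δʳ⇒ {A} {B} {C} ⊕₁ δʳ⇒ {A} {B} {D}) ∘ δˡ⇒ {A ⊕₀ B} {C} {D}
      ≈ (δˡ⇒ {A} {C} {D} ⊕₁ δˡ⇒ {B} {C} {D}) ∘ δʳ⇒ {A} {B} {C ⊕₀ D}
    laplaza-X     : λ*⇒ {𝟘} ≈ ρ*⇒ {𝟘}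
    laplaza-XI    : ∀ {A B} →
      λ*⇒ {A ⊕₀ B} ≈ λ⊕⇒ ∘ (λ*⇒ {A} ⊕₁ λ*⇒ {B}) ∘ δˡ⇒ {𝟘} {A} {B}
    laplaza-XII   : ∀ {A B} →
      ρ*⇒ {A ⊕₀ B} ≈ λ⊕⇒ ∘ (ρ*⇒ {A} ⊕₁ ρ*⇒ {B}) ∘ δʳ⇒ {A} {B} {𝟘}
    laplaza-XIII  : λ*⇒ {𝟙} ≈ ρ⊗⇒ {𝟘}
    laplaza-XIV   : ∀ {A} → ρ*⇒ {A} ≈ λ*⇒ {A} ∘ σ⊗⇒ {A} {𝟘}
    laplaza-XV    : ∀ {A B} →
      λ*⇒ {A ⊗₀ B} ∘ α⊗⇒ {𝟘} {A} {B} ≈ λ*⇒ {B} ∘ (λ*⇒ {A} ⊗₁ id {B})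
    laplaza-XVI   : ∀ {A B} →
      ρ*⇒ {A} ∘ (id {A} ⊗₁ λ*⇒ {B}) ∘ α⊗⇒ {A} {𝟘} {B} ≈ λ*⇒ {B} ∘ (ρ*⇒ {A} ⊗₁ id {B})
    laplaza-XVII  : ∀ {A B} →
      ρ*⇒ {A} ∘ (id {A} ⊗₁ ρ*⇒ {B}) ∘ α⊗⇒ {A} {B} {𝟘} ≈ ρ*⇒ {A ⊗₀ B}
    laplaza-XVIII : ∀ {A B} →
      λ⊕⇒ ∘ (ρ*⇒ {A} ⊕₁ id) ∘ δˡ⇒ {A} {𝟘} {B} ≈ id {A} ⊗₁ λ⊕⇒ {B}
    laplaza-XIX   : ∀ {A B} →
      λ⊕⇒ ∘ (λ*⇒ {B} ⊕₁ id) ∘ δʳ⇒ {𝟘} {A} {B} ≈ λ⊕⇒ {A} ⊗₁ id {B}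
    laplaza-XX    : ∀ {A B} →
      ρ⊕⇒ ∘ (id ⊕₁ ρ*⇒ {A}) ∘ δˡ⇒ {A} {B} {𝟘} ≈ id {A} ⊗₁ ρ⊕⇒ {B}
    laplaza-XXI   : ∀ {A B} →
      ρ⊕⇒ ∘ (id ⊕₁ λ*⇒ {B}) ∘ δʳ⇒ {A} {𝟘} {B} ≈ ρ⊕⇒ {A} ⊗₁ id {B}
    laplaza-XXII  : ∀ {A B} →
      (λ⊗⇒ {A} ⊕₁ λ⊗⇒ {B}) ∘ δˡ⇒ {𝟙} {A} {B} ≈ λ⊗⇒ {A ⊕₀ B}
    laplaza-XXIII : ∀ {A B} →
      (ρ⊗⇒ {A} ⊕₁ ρ⊗⇒ {B}) ∘ δʳ⇒ {A} {B} {𝟙} ≈ ρ⊗⇒ {A ⊕₀ B}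
    laplaza-XXIV  : λ⊗⇒ {𝟘} ≈ ρ*⇒ {𝟙}

module Strictification {o ℓ e : Level} (R : RigCategory o ℓ e) where
  open RigCategory R

  -- formal pairs of mutually inverse structural maps (used to build the
  -- canonical isomorphisms and their inverses simultaneously)
  record Pair (X Y : Obj) : Set ℓ where
    constructor pair
    field
      fwd : X ⇒ Y
      bwd : Y ⇒ X
  open Pair public

  iso→pair : ∀ {X Y} → Iso cat X Y → Pair X Y
  iso→pair i = pair (Iso.from i) (Iso.to i)

  inv : ∀ {X Y} → Pair X Y → Pair Y X
  inv p = pair (bwd p) (fwd p)

  idᵖ : ∀ {X} → Pair X X
  idᵖ = pair id id

  infixr 5 _⨾_
  _⨾_ : ∀ {X Y Z} → Pair X Y → Pair Y Z → Pair X Z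
  p ⨾ q = pair (fwd q ∘ fwd p) (bwd p ∘ bwd q)

  _⊗ᵖ_ : ∀ {X Y Z W} → Pair X Y → Pair Z W → Pair (X ⊗₀ Z) (Y ⊗₀ W)
  p ⊗ᵖ q = pair (fwd p ⊗₁ fwd q) (bwd p ⊗₁ bwd q)

  _⊕ᵖ_ : ∀ {X Y Z W} → Pair X Y → Pair Z W → Pair (X ⊕₀ Z) (Y ⊕₀ W)
  p ⊕ᵖ q = pair (fwd p ⊕₁ fwd q) (bwd p ⊕₁ bwd q)

  -- objects of s(C): words of words of objects of C
  Word : Set o
  Word = List Obj

  Poly : Set o
  Poly = List Word

  πw : Word → Obj
  πw []           = 𝟙
  πw (A ∷ [])     = A
  πw (A ∷ B ∷ w)  = A ⊗₀ πw (B ∷ w)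

  πp : Poly → Obj
  πp []           = 𝟘
  πp (U ∷ [])     = πw U
  πp (U ∷ V ∷ P)  = πw U ⊕₀ πp (V ∷ P)

  infixr 7 _⊗ˢ_
  _⊗ˢ_ : Poly → Poly → Poly
  []      ⊗ˢ Q = []
  (U ∷ P) ⊗ˢ Q = map (U ++_) Q ++ (P ⊗ˢ Q)

  μ : (U V : Word) → Pair (πw (U ++ V)) (πw U ⊗₀ πw V)
  μ []            V       = inv (iso→pair λ⊗)
  μ (A ∷ [])      []      = inv (iso→pair ρ⊗)
  μ (A ∷ [])      (B ∷ V) = idᵖ
  μ (A ∷ B ∷ U)   V       = (idᵖ {A} ⊗ᵖ μ (B ∷ U) V) ⨾ inv (iso→pair α⊗)

  φ : (P Q : Poly) → Pair (πp (P ++ Q)) (πp P ⊕₀ πp Q)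
  φ []            Q       = inv (iso→pair λ⊕)
  φ (U ∷ [])      []      = inv (iso→pair ρ⊕)
  φ (U ∷ [])      (V ∷ Q) = idᵖ
  φ (U ∷ V ∷ P)   Q       = (idᵖ {πw U} ⊕ᵖ φ (V ∷ P) Q) ⨾ inv (iso→pair α⊕)

  θ : (U : Word) (Q : Poly) → Pair (πp (map (U ++_) Q)) (πw U ⊗₀ πp Q)
  θ U []      = inv (iso→pair ρ*)
  θ U (V ∷ Q) = φ [ U ++ V ] (map (U ++_) Q) ⨾ (μ U V ⊕ᵖ θ U Q)
                ⨾ inv (iso→pair δˡ) ⨾ (idᵖ ⊗ᵖ inv (φ [ V ] Q))

  ψ : (P Q : Poly) → Pair (πp (P ⊗ˢ Q)) (πp P ⊗₀ πp Q)
  ψ []      Q = inv (iso→pair λ*)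
  ψ (U ∷ P) Q = φ (map (U ++_) Q) (P ⊗ˢ Q) ⨾ (θ U Q ⊕ᵖ ψ P Q)
                ⨾ inv (iso→pair δʳ) ⨾ (inv (φ [ U ] P) ⊗ᵖ idᵖ)

  _⇒ˢ_ : Poly → Poly → Set ℓ
  P ⇒ˢ Q = πp P ⇒ πp Q

  castˢ : ∀ {P Q} → P ≡ Q → P ⇒ˢ Q
  castˢ refl = id

  IsIdentityˢ : (P Q : Poly) → P ⇒ˢ Q → Set (o ⊔ e)
  IsIdentityˢ P Q f = Σ (P ≡ Q) (λ eq → f ≈ castˢ eq)

  σˢ : (P Q : Poly) → (P ⊗ˢ Q) ⇒ˢ (Q ⊗ˢ P)
  σˢ P Q = bwd (ψ Q P) ∘ σ⊗⇒ ∘ fwd (ψ P Q)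

  ⊕ˢ₁ : ∀ {P P′ Q Q′} → P ⇒ˢ P′ → Q ⇒ˢ Q′ → (P ++ Q) ⇒ˢ (P′ ++ Q′)
  ⊕ˢ₁ {P} {P′} {Q} {Q′} f g = bwd (φ P′ Q′) ∘ (f ⊕₁ g) ∘ fwd (φ P Q)

  distribʳ-obj : (P Q S : Poly) → (P ++ Q) ⊗ˢ S ≡ (P ⊗ˢ S) ++ (Q ⊗ˢ S)
  distribʳ-obj []      Q S = refl
  distribʳ-obj (U ∷ P) Q S =
    trans (cong (map (U ++_) S ++_) (distribʳ-obj P Q S))
          (sym (++-assoc (map (U ++_) S) (P ⊗ˢ S) (Q ⊗ˢ S)))

  δˡˢ : (S P Q : Poly) → (S ⊗ˢ (P ++ Q)) ⇒ˢ ((S ⊗ˢ P) ++ (S ⊗ˢ Q))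
  δˡˢ S P Q = ⊕ˢ₁ {P ⊗ˢ S} {S ⊗ˢ P} {Q ⊗ˢ S} {S ⊗ˢ Q} (σˢ P S) (σˢ Q S)
              ∘ castˢ (distribʳ-obj P Q S) ∘ σˢ S (P ++ Q)

  H : Obj → Poly
  H A = [ [ A ] ]

{-# OPTIONS --safe #-}
module Submission where

-- Write S = H A. In S ⊗ P each monomial of P carries the letter A in front, in P ⊗ S at
-- the back, and the symmetry σ_{S,P} of s(C) is the ⊕-sum over the monomials U of P of
-- the braidings A·U → U·A (push σ⊗ through the canonical isomorphisms by its naturality
-- and Laplaza's axiom III). A monomialwise sum splits along P ⊕ Q, so in
-- δˡ = σ_{S,P⊕Q} ; (σ_{P,S} ⊕ σ_{Q,S}) each summand is undone by its inverse, leaving a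
-- composite of canonical isomorphisms between equal objects, that is, an identity.

open import Level using (Level)
open import Data.List using ([]; _∷_; _++_; map; [_])
open import Data.List.Properties using (map-++; ++-identityʳ)
open import Data.Product using (_,_)
open import Relation.Binary using (Setoid)
import Relation.Binary.Reasoning.Setoid as SetoidReasoning
open import Relation.Binary.PropositionalEquality using (_≡_; refl; cong₂; trans; sym)
open import Defs

module HomReasoning {o ℓ e : Level} (C : Category o ℓ e) where
  open Category C

  hom-setoid : Obj → Obj → Setoid ℓ e
  hom-setoid A B = record { Carrier = A ⇒ B ; _≈_ = _≈_ ; isEquivalence = equiv }

  module _ {A B : Obj} where
    open Setoid (hom-setoid A B) public
      using () renaming (refl to ≈-refl; sym to ≈-sym; trans to ≈-trans)
    open SetoidReasoning (hom-setoid A B) public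

  infixr 4 _○_
  _○_ : ∀ {A B} {f g h : A ⇒ B} → f ≈ g → g ≈ h → f ≈ h
  _○_ = ≈-trans

  infixr 5 refl⟩∘⟨_
  infixl 5 _⟩∘⟨refl
  refl⟩∘⟨_ : ∀ {A B C} {h : B ⇒ C} {f g : A ⇒ B} → f ≈ g → h ∘ f ≈ h ∘ g
  refl⟩∘⟨ p = ∘-resp-≈ ≈-refl p
  _⟩∘⟨refl : ∀ {A B C} {g h : B ⇒ C} {f : A ⇒ B} → g ≈ h → g ∘ f ≈ h ∘ f
  p ⟩∘⟨refl = ∘-resp-≈ p ≈-refl

  sym-assoc : ∀ {A B C D} {f : A ⇒ B} {g : B ⇒ C} {h : C ⇒ D} → h ∘ (g ∘ f) ≈ (h ∘ g) ∘ f
  sym-assoc = ≈-sym assoc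

  pullˡ : ∀ {A B C D} {f : B ⇒ C} {g : C ⇒ D} {k : B ⇒ D} {x : A ⇒ B} →
          g ∘ f ≈ k → g ∘ (f ∘ x) ≈ k ∘ x
  pullˡ p = sym-assoc ○ p ⟩∘⟨refl

  cancelˡ : ∀ {A B C} {f : B ⇒ C} {g : C ⇒ B} {x : A ⇒ B} → g ∘ f ≈ id → g ∘ (f ∘ x) ≈ x
  cancelˡ p = pullˡ p ○ identityˡ

  cancelʳ : ∀ {A B C} {f : B ⇒ C} {g : C ⇒ B} {x : B ⇒ A} → g ∘ f ≈ id → (x ∘ g) ∘ f ≈ x
  cancelʳ p = assoc ○ refl⟩∘⟨ p ○ identityʳ

  module _ {X Y : Obj} (i : Iso C X Y) where
    open Iso i

    Iso-from-mono : ∀ {Z} {f g : Z ⇒ X} → from ∘ f ≈ from ∘ g → f ≈ g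
    Iso-from-mono p = ≈-sym (cancelˡ isoˡ) ○ refl⟩∘⟨ p ○ cancelˡ isoˡ

    Iso-from-epi : ∀ {Z} {f g : Y ⇒ Z} → f ∘ from ≈ g ∘ from → f ≈ g
    Iso-from-epi p = ≈-sym (cancelʳ isoʳ) ○ p ⟩∘⟨refl ○ cancelʳ isoʳ

  to-square : ∀ {X Y X′ Y′} (i : Iso C X Y) (j : Iso C X′ Y′) {f : X ⇒ X′} {g : Y ⇒ Y′} →
              Iso.from j ∘ f ≈ g ∘ Iso.from i → f ∘ Iso.to i ≈ Iso.to j ∘ g
  to-square i j p =
    ≈-sym (cancelˡ (Iso.isoˡ j))
    ○ refl⟩∘⟨ (sym-assoc ○ p ⟩∘⟨refl ○ assoc ○ refl⟩∘⟨ Iso.isoʳ i ○ identityʳ)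

module MonoidalProperties {o ℓ e : Level} {C : Category o ℓ e} (M : SymmetricMonoidal C) where
  open Category C
  open HomReasoning C
  open SymmetricMonoidal M

  α⇒ : ∀ {X Y Z} → ((X ⊗₀ Y) ⊗₀ Z) ⇒ (X ⊗₀ (Y ⊗₀ Z))
  α⇒ = Iso.from associator
  α⇐ : ∀ {X Y Z} → (X ⊗₀ (Y ⊗₀ Z)) ⇒ ((X ⊗₀ Y) ⊗₀ Z)
  α⇐ = Iso.to associator
  λ⇒ : ∀ {X} → (unit ⊗₀ X) ⇒ X
  λ⇒ = Iso.from unitorˡ
  ρ⇒ : ∀ {X} → (X ⊗₀ unit) ⇒ X
  ρ⇒ = Iso.from unitorʳ

  ⊗-merge : ∀ {A B C D E F} {f : A ⇒ B} {g : B ⇒ C} {h : D ⇒ E} {k : E ⇒ F} →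
            (g ⊗₁ k) ∘ (f ⊗₁ h) ≈ (g ∘ f) ⊗₁ (k ∘ h)
  ⊗-merge = ≈-sym ⊗-homo

  unitorˡ⇐-nat : ∀ {A B} {f : A ⇒ B} → (id ⊗₁ f) ∘ Iso.to unitorˡ ≈ Iso.to unitorˡ ∘ f
  unitorˡ⇐-nat = to-square unitorˡ unitorˡ unitorˡ-nat

  unitorʳ⇐-nat : ∀ {A B} {f : A ⇒ B} → (f ⊗₁ id) ∘ Iso.to unitorʳ ≈ Iso.to unitorʳ ∘ f
  unitorʳ⇐-nat = to-square unitorʳ unitorʳ unitorʳ-nat

  assoc⇐-nat : ∀ {A B C D E F} {f : A ⇒ D} {g : B ⇒ E} {h : C ⇒ F} →
               ((f ⊗₁ g) ⊗₁ h) ∘ α⇐ ≈ α⇐ ∘ (f ⊗₁ (g ⊗₁ h))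
  assoc⇐-nat = to-square associator associator assoc-nat

  ⊗id-injective : ∀ {A B} {f g : A ⇒ B} → f ⊗₁ id {unit} ≈ g ⊗₁ id {unit} → f ≈ g
  ⊗id-injective p = Iso-from-epi unitorʳ (≈-sym unitorʳ-nat ○ refl⟩∘⟨ p ○ unitorʳ-nat)

  id⊗-injective : ∀ {A B} {f g : A ⇒ B} → id {unit} ⊗₁ f ≈ id {unit} ⊗₁ g → f ≈ g
  id⊗-injective p = Iso-from-epi unitorˡ (≈-sym unitorˡ-nat ○ refl⟩∘⟨ p ○ unitorˡ-nat)

  unitorʳ⊗id : ∀ {X} → ρ⇒ {X} ⊗₁ id {unit} ≈ ρ⇒ {X ⊗₀ unit}
  unitorʳ⊗id = Iso-from-mono unitorʳ unitorʳ-nat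

  -- Kelly's argument: after tensoring with id and composing with α⇒ both sides
  -- agree, by the triangle, the pentagon and naturality of α⇒.
  unitorʳ-assoc : ∀ {X Y} → (id ⊗₁ ρ⇒ {Y}) ∘ α⇒ {X} {Y} {unit} ≈ ρ⇒ {X ⊗₀ Y}
  unitorʳ-assoc = ≈-sym (⊗id-injective (Iso-from-mono associator (begin
    α⇒ ∘ (ρ⇒ ⊗₁ id)
      ≈⟨ refl⟩∘⟨ triangle ⟨
    α⇒ ∘ ((id ⊗₁ λ⇒) ∘ α⇒)
      ≈⟨ refl⟩∘⟨ (⊗-resp-≈ ⊗-identity ≈-refl ⟩∘⟨refl) ⟨
    α⇒ ∘ (((id ⊗₁ id) ⊗₁ λ⇒) ∘ α⇒)
      ≈⟨ pullˡ assoc-nat ○ assoc ⟩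
    (id ⊗₁ (id ⊗₁ λ⇒)) ∘ (α⇒ ∘ α⇒)
      ≈⟨ refl⟩∘⟨ pentagon ⟩
    (id ⊗₁ (id ⊗₁ λ⇒)) ∘ ((id ⊗₁ α⇒) ∘ (α⇒ ∘ (α⇒ ⊗₁ id)))
      ≈⟨ pullˡ (⊗-merge ○ ⊗-resp-≈ identityˡ triangle) ⟩
    (id ⊗₁ (ρ⇒ ⊗₁ id)) ∘ (α⇒ ∘ (α⇒ ⊗₁ id))
      ≈⟨ pullˡ (≈-sym assoc-nat) ○ assoc ⟩
    α⇒ ∘ (((id ⊗₁ ρ⇒) ⊗₁ id) ∘ (α⇒ ⊗₁ id))
      ≈⟨ refl⟩∘⟨ (⊗-merge ○ ⊗-resp-≈ ≈-refl identityˡ) ⟩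
    α⇒ ∘ (((id ⊗₁ ρ⇒) ∘ α⇒) ⊗₁ id)  ∎)))

  unitorʳ-assoc⇐ : ∀ {X Y} → ρ⇒ {X ⊗₀ Y} ∘ α⇐ ≈ id ⊗₁ ρ⇒ {Y}
  unitorʳ-assoc⇐ = ≈-sym unitorʳ-assoc ⟩∘⟨refl ○ cancelʳ (Iso.isoʳ associator)

  unitorˡ≈unitorʳ : λ⇒ {unit} ≈ ρ⇒ {unit}
  unitorˡ≈unitorʳ =
    id⊗-injective (Iso-from-epi associator (triangle ○ unitorʳ⊗id ○ ≈-sym unitorʳ-assoc))

module StrictificationProperties {o ℓ e : Level} (R : RigCategory o ℓ e) where
  open RigCategory R
  open Strictification R
  open HomReasoning cat
  module ⊕ where
    open SymmetricMonoidal ⊕M public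
    open MonoidalProperties ⊕M public
  module ⊗ where
    open SymmetricMonoidal ⊗M public
    open MonoidalProperties ⊗M public

  record IsInverse {X Y : Obj} (p : Pair X Y) : Set e where
    field
      bwd∘fwd : bwd p ∘ fwd p ≈ id
      fwd∘bwd : fwd p ∘ bwd p ≈ id
  open IsInverse

  iso→pair-inverse : ∀ {X Y} (i : Iso cat X Y) → IsInverse (iso→pair i)
  iso→pair-inverse i = record { bwd∘fwd = Iso.isoˡ i ; fwd∘bwd = Iso.isoʳ i }

  inv-inverse : ∀ {X Y} {p : Pair X Y} → IsInverse p → IsInverse (inv p)
  inv-inverse v = record { bwd∘fwd = fwd∘bwd v ; fwd∘bwd = bwd∘fwd v }

  inv-iso→pair-inverse : ∀ {X Y} (i : Iso cat X Y) → IsInverse (inv (iso→pair i))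
  inv-iso→pair-inverse i = inv-inverse (iso→pair-inverse i)

  idᵖ-inverse : ∀ {X} → IsInverse (idᵖ {X})
  idᵖ-inverse = record { bwd∘fwd = identityˡ ; fwd∘bwd = identityˡ }

  ⨾-inverse : ∀ {X Y Z} {p : Pair X Y} {q : Pair Y Z} →
    IsInverse p → IsInverse q → IsInverse (p ⨾ q)
  ⨾-inverse v w = record
    { bwd∘fwd = assoc ○ refl⟩∘⟨ cancelˡ (bwd∘fwd w) ○ bwd∘fwd v
    ; fwd∘bwd = assoc ○ refl⟩∘⟨ cancelˡ (fwd∘bwd v) ○ fwd∘bwd w
    }

  ⊗ᵖ-inverse : ∀ {X Y Z W} {p : Pair X Y} {q : Pair Z W} →
    IsInverse p → IsInverse q → IsInverse (p ⊗ᵖ q)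
  ⊗ᵖ-inverse v w = record
    { bwd∘fwd = ⊗.⊗-merge ○ ⊗.⊗-resp-≈ (bwd∘fwd v) (bwd∘fwd w) ○ ⊗.⊗-identity
    ; fwd∘bwd = ⊗.⊗-merge ○ ⊗.⊗-resp-≈ (fwd∘bwd v) (fwd∘bwd w) ○ ⊗.⊗-identity
    }

  ⊕ᵖ-inverse : ∀ {X Y Z W} {p : Pair X Y} {q : Pair Z W} →
    IsInverse p → IsInverse q → IsInverse (p ⊕ᵖ q)
  ⊕ᵖ-inverse v w = record
    { bwd∘fwd = ⊕.⊗-merge ○ ⊕.⊗-resp-≈ (bwd∘fwd v) (bwd∘fwd w) ○ ⊕.⊗-identity
    ; fwd∘bwd = ⊕.⊗-merge ○ ⊕.⊗-resp-≈ (fwd∘bwd v) (fwd∘bwd w) ○ ⊕.⊗-identity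
    }

  μ-inverse : ∀ U V → IsInverse (μ U V)
  μ-inverse []          V       = inv-iso→pair-inverse λ⊗
  μ-inverse (A ∷ [])    []      = inv-iso→pair-inverse ρ⊗
  μ-inverse (A ∷ [])    (B ∷ V) = idᵖ-inverse
  μ-inverse (A ∷ B ∷ U) V       = ⨾-inverse (⊗ᵖ-inverse idᵖ-inverse (μ-inverse (B ∷ U) V))
                                             (inv-iso→pair-inverse α⊗)

  φ-inverse : ∀ P Q → IsInverse (φ P Q)
  φ-inverse []          Q       = inv-iso→pair-inverse λ⊕
  φ-inverse (U ∷ [])    []      = inv-iso→pair-inverse ρ⊕
  φ-inverse (U ∷ [])    (V ∷ Q) = idᵖ-inverse
  φ-inverse (U ∷ V ∷ P) Q       = ⨾-inverse (⊕ᵖ-inverse idᵖ-inverse (φ-inverse (V ∷ P) Q))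
                                             (inv-iso→pair-inverse α⊕)

  θ-inverse : ∀ U Q → IsInverse (θ U Q)
  θ-inverse U []      = inv-iso→pair-inverse ρ*
  θ-inverse U (V ∷ Q) =
    ⨾-inverse (φ-inverse [ U ++ V ] (map (U ++_) Q))
    (⨾-inverse (⊕ᵖ-inverse (μ-inverse U V) (θ-inverse U Q))
    (⨾-inverse (inv-iso→pair-inverse δˡ) (⊗ᵖ-inverse idᵖ-inverse (inv-inverse (φ-inverse [ V ] Q)))))

  ψ-inverse : ∀ P Q → IsInverse (ψ P Q)
  ψ-inverse []      Q = inv-iso→pair-inverse λ*
  ψ-inverse (U ∷ P) Q =
    ⨾-inverse (φ-inverse (map (U ++_) Q) (P ⊗ˢ Q))
    (⨾-inverse (⊕ᵖ-inverse (θ-inverse U Q) (ψ-inverse P Q))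
    (⨾-inverse (inv-iso→pair-inverse δʳ) (⊗ᵖ-inverse (inv-inverse (φ-inverse [ U ] P)) idᵖ-inverse)))

  castˢ-irrelevant : ∀ {P Q} (p q : P ≡ Q) → castˢ p ≈ castˢ q
  castˢ-irrelevant refl refl = ≈-refl

  castˢ-trans : ∀ {P Q T} (p : P ≡ Q) (q : Q ≡ T) (r : P ≡ T) → castˢ q ∘ castˢ p ≈ castˢ r
  castˢ-trans refl q r = identityʳ ○ castˢ-irrelevant q r

  castˢ-∷ : ∀ {W V₁ V₂ X Y} (p : W ∷ V₁ ∷ X ≡ W ∷ V₂ ∷ Y) (q : V₁ ∷ X ≡ V₂ ∷ Y) →
            castˢ p ≈ id ⊕₁ castˢ q
  castˢ-∷ p refl = castˢ-irrelevant p refl ○ ≈-sym ⊕.⊗-identity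

  braiding-δˡ⇐ : ∀ {A B C} →
                 σ⊗⇒ {C} {A ⊕₀ B} ∘ Iso.to δˡ ≈ Iso.to (δʳ {A} {B} {C}) ∘ (σ⊗⇒ ⊕₁ σ⊗⇒)
  braiding-δˡ⇐ {A} {B} {C} = begin
    σ⊗⇒ ∘ Iso.to δˡ
      ≈⟨ refl⟩∘⟨ σ⊕σ-involutive ○ identityʳ ⟨
    (σ⊗⇒ ∘ Iso.to δˡ) ∘ ((σ⊗⇒ ⊕₁ σ⊗⇒) ∘ (σ⊗⇒ ⊕₁ σ⊗⇒))
      ≈⟨ assoc ○ refl⟩∘⟨ sym-assoc ⟩
    σ⊗⇒ ∘ ((Iso.to δˡ ∘ (σ⊗⇒ ⊕₁ σ⊗⇒)) ∘ (σ⊗⇒ ⊕₁ σ⊗⇒))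
      ≈⟨ refl⟩∘⟨ (to-square δʳ δˡ (≈-sym laplaza-III) ⟩∘⟨refl) ⟨
    σ⊗⇒ ∘ ((σ⊗⇒ ∘ Iso.to δʳ) ∘ (σ⊗⇒ ⊕₁ σ⊗⇒))
      ≈⟨ refl⟩∘⟨ assoc ○ pullˡ ⊗.commutative ○ identityˡ ⟩
    Iso.to δʳ ∘ (σ⊗⇒ ⊕₁ σ⊗⇒)  ∎
    where
    σ⊕σ-involutive : (σ⊗⇒ {A} {C} ⊕₁ σ⊗⇒ {B} {C}) ∘ (σ⊗⇒ ⊕₁ σ⊗⇒) ≈ id
    σ⊕σ-involutive = ⊕.⊗-merge ○ ⊕.⊗-resp-≈ ⊗.commutative ⊗.commutative ○ ⊕.⊗-identity

  id⊗unitor⊕ʳ-δˡ⇐ : ∀ {A B} → (id {A} ⊗₁ ρ⊕⇒ {B}) ∘ Iso.to δˡ ≈ ρ⊕⇒ ∘ (id ⊕₁ ρ*⇒ {A})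
  id⊗unitor⊕ʳ-δˡ⇐ = ≈-sym laplaza-XX ⟩∘⟨refl ○ assoc ○ refl⟩∘⟨ cancelʳ (Iso.isoʳ δˡ)

  unitor⊕ʳ⊗id-δʳ⇐ : ∀ {A B} → (ρ⊕⇒ {A} ⊗₁ id {B}) ∘ Iso.to δʳ ≈ ρ⊕⇒ ∘ (id ⊕₁ λ*⇒ {B})
  unitor⊕ʳ⊗id-δʳ⇐ = ≈-sym laplaza-XXI ⟩∘⟨refl ○ assoc ○ refl⟩∘⟨ cancelʳ (Iso.isoʳ δʳ)

  braiding-ρ*⇐ : ∀ {A} → σ⊗⇒ {A} {𝟘} ∘ Iso.to ρ* ≈ Iso.to λ*
  braiding-ρ*⇐ =
    Iso-from-mono λ* (sym-assoc ○ ≈-sym laplaza-XIV ⟩∘⟨refl ○ Iso.isoʳ ρ* ○ ≈-sym (Iso.isoʳ λ*))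

  ⊕ˢ₁-castˢ : ∀ {P P′ Q Q′} (p : P ≡ P′) (q : Q ≡ Q′) (r : P ++ Q ≡ P′ ++ Q′) →
              ⊕ˢ₁ {P} {P′} {Q} {Q′} (castˢ p) (castˢ q) ≈ castˢ r
  ⊕ˢ₁-castˢ {P} {_} {Q} refl refl r =
    refl⟩∘⟨ (⊕.⊗-identity ⟩∘⟨refl ○ identityˡ) ○ bwd∘fwd (φ-inverse P Q)
    ○ castˢ-irrelevant refl r

  ρˢ : (P : Poly) → (P ++ []) ⇒ˢ P
  ρˢ P = ρ⊕⇒ ∘ fwd (φ P [])

  ρˢ⁻¹ : (P : Poly) → P ⇒ˢ (P ++ [])
  ρˢ⁻¹ P = bwd (φ P []) ∘ Iso.to ρ⊕

  ρˢ∘ρˢ⁻¹ : ∀ P → ρˢ P ∘ ρˢ⁻¹ P ≈ id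
  ρˢ∘ρˢ⁻¹ P = assoc ○ refl⟩∘⟨ cancelˡ (fwd∘bwd (φ-inverse P [])) ○ Iso.isoʳ ρ⊕

  ρˢ-castˢ : ∀ P (eq : P ++ [] ≡ P) → ρˢ P ≈ castˢ eq
  ρˢ-castˢ []          eq =
    ≈-sym ⊕.unitorˡ≈unitorʳ ⟩∘⟨refl ○ Iso.isoʳ λ⊕ ○ castˢ-irrelevant refl eq
  ρˢ-castˢ (U ∷ [])    eq = Iso.isoʳ ρ⊕ ○ castˢ-irrelevant refl eq
  ρˢ-castˢ (U ∷ V ∷ P) eq =
    pullˡ ⊕.unitorʳ-assoc⇐ ○ ⊕.⊗-merge ○ ⊕.⊗-resp-≈ identityˡ (ρˢ-castˢ (V ∷ P) eq′)
    ○ ≈-sym (castˢ-∷ eq eq′)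
    where eq′ = ++-identityʳ (V ∷ P)

  ρˢ⁻¹-castˢ : ∀ P (eq : P ≡ P ++ []) → ρˢ⁻¹ P ≈ castˢ eq
  ρˢ⁻¹-castˢ P eq = begin
    ρˢ⁻¹ P                                ≈⟨ identityˡ ⟨
    id ∘ ρˢ⁻¹ P                           ≈⟨ castˢ-trans (sym eq) eq refl ⟩∘⟨refl ⟨
    (castˢ eq ∘ castˢ (sym eq)) ∘ ρˢ⁻¹ P  ≈⟨ (refl⟩∘⟨ ρˢ-castˢ P (sym eq)) ⟩∘⟨refl ⟨
    (castˢ eq ∘ ρˢ P) ∘ ρˢ⁻¹ P            ≈⟨ assoc ○ refl⟩∘⟨ ρˢ∘ρˢ⁻¹ P ○ identityʳ ⟩
    castˢ eq                              ∎

  module OneLetter (A : Obj) where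
    prefix : Poly → Poly
    prefix = map ([ A ] ++_)

    braidʷ : (U : Word) → πw ([ A ] ++ U) ⇒ πw (U ++ [ A ])
    braidʷ U = bwd (μ U [ A ]) ∘ σ⊗⇒ ∘ fwd (μ [ A ] U)

    braidᵖ : (X : Poly) → prefix X ⇒ˢ (X ⊗ˢ H A)
    braidᵖ []          = id
    braidᵖ (U ∷ [])    = braidʷ U
    braidᵖ (U ∷ V ∷ X) = braidʷ U ⊕₁ braidᵖ (V ∷ X)

    braidᵖ-∷ : ∀ U X → braidᵖ (U ∷ X) ≈ bwd (φ [ U ++ [ A ] ] (X ⊗ˢ H A))
                                      ∘ (braidʷ U ⊕₁ braidᵖ X) ∘ fwd (φ [ [ A ] ++ U ] (prefix X))
    braidᵖ-∷ U []      = ≈-sym (pullˡ ⊕.unitorʳ-nat ○ cancelʳ (Iso.isoʳ ρ⊕))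
    braidᵖ-∷ U (V ∷ X) = ≈-sym (identityˡ ○ identityʳ)

    θ-one-letterʳ : ∀ U → fwd (θ U (H A)) ≈ fwd (μ U [ A ])
    θ-one-letterʳ U = begin
      (((id ⊗₁ ρ⊕⇒) ∘ Iso.to δˡ) ∘ (fwd (μ U [ A ]) ⊕₁ Iso.to ρ*)) ∘ Iso.to ρ⊕
        ≈⟨ id⊗unitor⊕ʳ-δˡ⇐ ⟩∘⟨refl ⟩∘⟨refl ⟩
      ((ρ⊕⇒ ∘ (id ⊕₁ ρ*⇒)) ∘ (fwd (μ U [ A ]) ⊕₁ Iso.to ρ*)) ∘ Iso.to ρ⊕
        ≈⟨ (assoc ○ refl⟩∘⟨ (⊕.⊗-merge ○ ⊕.⊗-resp-≈ identityˡ (Iso.isoʳ ρ*))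
            ○ ⊕.unitorʳ-nat) ⟩∘⟨refl ⟩
      (fwd (μ U [ A ]) ∘ ρ⊕⇒) ∘ Iso.to ρ⊕
        ≈⟨ cancelʳ (Iso.isoʳ ρ⊕) ⟩
      fwd (μ U [ A ])  ∎

    ψ-one-letterˡ : ∀ X → fwd (ψ (H A) X) ≈ fwd (θ [ A ] X) ∘ ρˢ (prefix X)
    ψ-one-letterˡ X = begin
      (((ρ⊕⇒ ⊗₁ id) ∘ Iso.to δʳ) ∘ (fwd (θ [ A ] X) ⊕₁ Iso.to λ*)) ∘ fwd (φ (prefix X) [])
        ≈⟨ unitor⊕ʳ⊗id-δʳ⇐ ⟩∘⟨refl ⟩∘⟨refl ⟩
      ((ρ⊕⇒ ∘ (id ⊕₁ λ*⇒)) ∘ (fwd (θ [ A ] X) ⊕₁ Iso.to λ*)) ∘ fwd (φ (prefix X) [])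
        ≈⟨ (assoc ○ refl⟩∘⟨ (⊕.⊗-merge ○ ⊕.⊗-resp-≈ identityˡ (Iso.isoʳ λ*))
            ○ ⊕.unitorʳ-nat) ⟩∘⟨refl ⟩
      (fwd (θ [ A ] X) ∘ ρ⊕⇒) ∘ fwd (φ (prefix X) [])
        ≈⟨ assoc ⟩
      fwd (θ [ A ] X) ∘ ρˢ (prefix X)  ∎

    braidʷ-square : ∀ V → σ⊗⇒ ∘ fwd (μ [ A ] V) ≈ fwd (θ V (H A)) ∘ braidʷ V
    braidʷ-square V = ≈-sym (θ-one-letterʳ V ⟩∘⟨refl ○ cancelˡ (fwd∘bwd (μ-inverse V [ A ])))

    braidᵖ-square : ∀ X → σ⊗⇒ ∘ fwd (θ [ A ] X) ≈ fwd (ψ X (H A)) ∘ braidᵖ X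
    braidᵖ-square []      = braiding-ρ*⇐ ○ ≈-sym identityʳ
    braidᵖ-square (V ∷ X) = begin
      σ⊗⇒ ∘ (((f₄ ∘ f₃) ∘ f₂) ∘ f₁)
        ≈⟨ refl⟩∘⟨ (assoc ○ assoc) ⟩
      σ⊗⇒ ∘ (f₄ ∘ (f₃ ∘ (f₂ ∘ f₁)))
        ≈⟨ pullˡ ⊗.braiding-nat ○ assoc ⟩
      g₄ ∘ (σ⊗⇒ ∘ (f₃ ∘ (f₂ ∘ f₁)))
        ≈⟨ refl⟩∘⟨ (pullˡ braiding-δˡ⇐ ○ assoc) ⟩
      g₄ ∘ (g₃ ∘ ((σ⊗⇒ ⊕₁ σ⊗⇒) ∘ (f₂ ∘ f₁)))
        ≈⟨ refl⟩∘⟨ refl⟩∘⟨ pullˡ squares ⟩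
      g₄ ∘ (g₃ ∘ (((fwd (θ V (H A)) ∘ braidʷ V) ⊕₁ (fwd (ψ X (H A)) ∘ braidᵖ X)) ∘ f₁))
        ≈⟨ refl⟩∘⟨ refl⟩∘⟨ pullˡ ⊕.⊗-merge ⟨
      g₄ ∘ (g₃ ∘ (g₂ ∘ ((braidʷ V ⊕₁ braidᵖ X) ∘ f₁)))
        ≈⟨ sym-assoc ○ sym-assoc ⟩
      ((g₄ ∘ g₃) ∘ g₂) ∘ ((braidʷ V ⊕₁ braidᵖ X) ∘ f₁)
        ≈⟨ refl⟩∘⟨ cancelˡ (fwd∘bwd (φ-inverse [ V ++ [ A ] ] (X ⊗ˢ H A))) ⟨
      ((g₄ ∘ g₃) ∘ g₂) ∘ (g₁ ∘ (g₁⁻¹ ∘ ((braidʷ V ⊕₁ braidᵖ X) ∘ f₁)))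
        ≈⟨ refl⟩∘⟨ braidᵖ-∷ V X ○ assoc ⟨
      fwd (ψ (V ∷ X) (H A)) ∘ braidᵖ (V ∷ X)  ∎
      where
      f₁ = fwd (φ [ [ A ] ++ V ] (prefix X))
      f₂ = fwd (μ [ A ] V) ⊕₁ fwd (θ [ A ] X)
      f₃ = Iso.to (δˡ {A} {πw V} {πp X})
      f₄ = id {A} ⊗₁ bwd (φ [ V ] X)
      g₁ = fwd (φ [ V ++ [ A ] ] (X ⊗ˢ H A))
      g₁⁻¹ = bwd (φ [ V ++ [ A ] ] (X ⊗ˢ H A))
      g₂ = fwd (θ V (H A)) ⊕₁ fwd (ψ X (H A))
      g₃ = Iso.to (δʳ {πw V} {πp X} {A})
      g₄ = bwd (φ [ V ] X) ⊗₁ id {A}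
      squares : (σ⊗⇒ ⊕₁ σ⊗⇒) ∘ f₂ ≈ (fwd (θ V (H A)) ∘ braidʷ V) ⊕₁ (fwd (ψ X (H A)) ∘ braidᵖ X)
      squares = ⊕.⊗-merge ○ ⊕.⊗-resp-≈ (braidʷ-square V) (braidᵖ-square X)

    -- H A ⊗ˢ X reduces to prefix X ++ [], hence the unitor ρˢ.
    σˢ-one-letterˡ : ∀ X → σˢ (H A) X ≈ braidᵖ X ∘ ρˢ (prefix X)
    σˢ-one-letterˡ X = begin
      bwd (ψ X (H A)) ∘ (σ⊗⇒ ∘ fwd (ψ (H A) X))
        ≈⟨ refl⟩∘⟨ refl⟩∘⟨ ψ-one-letterˡ X ⟩
      bwd (ψ X (H A)) ∘ (σ⊗⇒ ∘ (fwd (θ [ A ] X) ∘ ρˢ (prefix X)))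
        ≈⟨ refl⟩∘⟨ pullˡ (braidᵖ-square X) ⟩
      bwd (ψ X (H A)) ∘ ((fwd (ψ X (H A)) ∘ braidᵖ X) ∘ ρˢ (prefix X))
        ≈⟨ refl⟩∘⟨ assoc ○ cancelˡ (bwd∘fwd (ψ-inverse X (H A))) ⟩
      braidᵖ X ∘ ρˢ (prefix X)  ∎

    σˢ-one-letterʳ : ∀ X → σˢ X (H A) ∘ braidᵖ X ≈ ρˢ⁻¹ (prefix X)
    σˢ-one-letterʳ X = begin
      (bwd (ψ (H A) X) ∘ (σ⊗⇒ ∘ fwd (ψ X (H A)))) ∘ braidᵖ X
        ≈⟨ refl⟩∘⟨ refl⟩∘⟨ braidᵖ-square X ○ refl⟩∘⟨ sym-assoc ○ sym-assoc ⟨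
      bwd (ψ (H A) X) ∘ (σ⊗⇒ ∘ (σ⊗⇒ ∘ fwd (θ [ A ] X)))
        ≈⟨ refl⟩∘⟨ (pullˡ ⊗.commutative ○ identityˡ) ⟩
      bwd (ψ (H A) X) ∘ fwd (θ [ A ] X)
        ≈⟨ refl⟩∘⟨ (refl⟩∘⟨ ρˢ∘ρˢ⁻¹ (prefix X) ○ identityʳ) ⟨
      bwd (ψ (H A) X) ∘ (fwd (θ [ A ] X) ∘ (ρˢ (prefix X) ∘ ρˢ⁻¹ (prefix X)))
        ≈⟨ refl⟩∘⟨ (ψ-one-letterˡ X ⟩∘⟨refl ○ assoc) ⟨
      bwd (ψ (H A) X) ∘ (fwd (ψ (H A) X) ∘ ρˢ⁻¹ (prefix X))
        ≈⟨ cancelˡ (bwd∘fwd (ψ-inverse (H A) X)) ⟩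
      ρˢ⁻¹ (prefix X)  ∎

    braidᵖ-++ : ∀ P Q (d : (P ++ Q) ⊗ˢ H A ≡ (P ⊗ˢ H A) ++ (Q ⊗ˢ H A))
                (m : prefix (P ++ Q) ≡ prefix P ++ prefix Q) →
                fwd (φ (P ⊗ˢ H A) (Q ⊗ˢ H A)) ∘ (castˢ d ∘ braidᵖ (P ++ Q))
                ≈ (braidᵖ P ⊕₁ braidᵖ Q) ∘ (fwd (φ (prefix P) (prefix Q)) ∘ castˢ m)
    braidᵖ-++ [] Q d m =
      refl⟩∘⟨ (castˢ-irrelevant d refl ⟩∘⟨refl ○ identityˡ) ○ ≈-sym ⊕.unitorˡ⇐-nat
      ○ refl⟩∘⟨ (≈-sym identityʳ ○ refl⟩∘⟨ castˢ-irrelevant refl m)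
    braidᵖ-++ (U ∷ []) [] d m =
      refl⟩∘⟨ (castˢ-irrelevant d refl ⟩∘⟨refl ○ identityˡ) ○ ≈-sym ⊕.unitorʳ⇐-nat
      ○ refl⟩∘⟨ (≈-sym identityʳ ○ refl⟩∘⟨ castˢ-irrelevant refl m)
    braidᵖ-++ (U ∷ []) (W ∷ Q) d m =
      identityˡ ○ castˢ-irrelevant d refl ⟩∘⟨refl ○ identityˡ ○ ≈-sym identityʳ
      ○ refl⟩∘⟨ (≈-sym identityˡ ○ refl⟩∘⟨ castˢ-irrelevant refl m)
    braidᵖ-++ (U ∷ V ∷ P) Q d m = begin
      (α⊕⇐ ∘ (id ⊕₁ fwd φ₁)) ∘ (castˢ d ∘ (braidʷ U ⊕₁ braidᵖ (V ∷ P ++ Q)))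
        ≈⟨ assoc ○ refl⟩∘⟨ refl⟩∘⟨ (castˢ-∷ d d′ ⟩∘⟨refl) ⟩
      α⊕⇐ ∘ ((id ⊕₁ fwd φ₁) ∘ ((id ⊕₁ castˢ d′) ∘ (braidʷ U ⊕₁ braidᵖ (V ∷ P ++ Q))))
        ≈⟨ refl⟩∘⟨ (refl⟩∘⟨ ⊕.⊗-merge ○ ⊕.⊗-merge ○ ⊕.⊗-resp-≈ (identityˡ ○ identityˡ) ≈-refl) ⟩
      α⊕⇐ ∘ (braidʷ U ⊕₁ (fwd φ₁ ∘ (castˢ d′ ∘ braidᵖ (V ∷ P ++ Q))))
        ≈⟨ refl⟩∘⟨ ⊕.⊗-resp-≈ (≈-sym identityʳ) (braidᵖ-++ (V ∷ P) Q d′ m′) ⟩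
      α⊕⇐ ∘ ((braidʷ U ∘ id) ⊕₁ ((braidᵖ (V ∷ P) ⊕₁ braidᵖ Q) ∘ (fwd φ₃ ∘ castˢ m′)))
        ≈⟨ refl⟩∘⟨ ⊕.⊗-merge ⟨
      α⊕⇐ ∘ ((braidʷ U ⊕₁ (braidᵖ (V ∷ P) ⊕₁ braidᵖ Q)) ∘ (id ⊕₁ (fwd φ₃ ∘ castˢ m′)))
        ≈⟨ pullˡ (≈-sym ⊕.assoc⇐-nat) ○ assoc ⟩
      ((braidʷ U ⊕₁ braidᵖ (V ∷ P)) ⊕₁ braidᵖ Q) ∘ (α⊕⇐ ∘ (id ⊕₁ (fwd φ₃ ∘ castˢ m′)))
        ≈⟨ refl⟩∘⟨ (assoc ○ refl⟩∘⟨ (⊕.⊗-merge ○ ⊕.⊗-resp-≈ identityˡ ≈-refl)) ⟨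
      ((braidʷ U ⊕₁ braidᵖ (V ∷ P)) ⊕₁ braidᵖ Q) ∘ ((α⊕⇐ ∘ (id ⊕₁ fwd φ₃)) ∘ (id ⊕₁ castˢ m′))
        ≈⟨ refl⟩∘⟨ refl⟩∘⟨ castˢ-∷ m m′ ⟨
      ((braidʷ U ⊕₁ braidᵖ (V ∷ P)) ⊕₁ braidᵖ Q) ∘ ((α⊕⇐ ∘ (id ⊕₁ fwd φ₃)) ∘ castˢ m)  ∎
      where
      d′ = distribʳ-obj (V ∷ P) Q (H A)
      m′ = map-++ ([ A ] ++_) (V ∷ P) Q
      φ₁ = φ ((V ∷ P) ⊗ˢ H A) (Q ⊗ˢ H A)
      φ₃ = φ (prefix (V ∷ P)) (prefix Q)

    δˡˢ-one-letter : ∀ P Q →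
      IsIdentityˢ (H A ⊗ˢ (P ++ Q)) ((H A ⊗ˢ P) ++ (H A ⊗ˢ Q)) (δˡˢ (H A) P Q)
    δˡˢ-one-letter P Q = eq , (begin
      (bwd φ₂ ∘ (σs ∘ fwd φ₁)) ∘ (castˢ d ∘ σˢ (H A) (P ++ Q))
        ≈⟨ refl⟩∘⟨ refl⟩∘⟨ σˢ-one-letterˡ (P ++ Q) ⟩
      (bwd φ₂ ∘ (σs ∘ fwd φ₁)) ∘ (castˢ d ∘ (braidᵖ (P ++ Q) ∘ ρP))
        ≈⟨ assoc ○ refl⟩∘⟨ (assoc ○ refl⟩∘⟨ (refl⟩∘⟨ sym-assoc ○ sym-assoc)) ⟩
      bwd φ₂ ∘ (σs ∘ ((fwd φ₁ ∘ (castˢ d ∘ braidᵖ (P ++ Q))) ∘ ρP))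
        ≈⟨ refl⟩∘⟨ refl⟩∘⟨ (braidᵖ-++ P Q d m ⟩∘⟨refl) ⟩
      bwd φ₂ ∘ (σs ∘ (((braidᵖ P ⊕₁ braidᵖ Q) ∘ (fwd φ₃ ∘ castˢ m)) ∘ ρP))
        ≈⟨ refl⟩∘⟨ (refl⟩∘⟨ assoc ○ sym-assoc ○ ∘-resp-≈ ⊕.⊗-merge assoc) ⟩
      bwd φ₂ ∘ (((σˢ P (H A) ∘ braidᵖ P) ⊕₁ (σˢ Q (H A) ∘ braidᵖ Q)) ∘ (fwd φ₃ ∘ (castˢ m ∘ ρP)))
        ≈⟨ refl⟩∘⟨ (⊕.⊗-resp-≈ (σˢ-one-letterʳ P ○ ρˢ⁻¹-castˢ _ a)
                               (σˢ-one-letterʳ Q ○ ρˢ⁻¹-castˢ _ b) ⟩∘⟨refl) ⟩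
      bwd φ₂ ∘ ((castˢ a ⊕₁ castˢ b) ∘ (fwd φ₃ ∘ (castˢ m ∘ ρP)))
        ≈⟨ refl⟩∘⟨ sym-assoc ○ sym-assoc ○ ∘-resp-≈ (⊕ˢ₁-castˢ a b c) (refl⟩∘⟨ ρˢ-castˢ _ n) ⟩
      castˢ c ∘ (castˢ m ∘ castˢ n)
        ≈⟨ refl⟩∘⟨ castˢ-trans n m (trans n m) ○ castˢ-trans (trans n m) c eq ⟩
      castˢ eq  ∎)
      where
      d  = distribʳ-obj P Q (H A)
      n  = ++-identityʳ (prefix (P ++ Q))
      m  = map-++ ([ A ] ++_) P Q
      a  = sym (++-identityʳ (prefix P))
      b  = sym (++-identityʳ (prefix Q))
      c  = cong₂ _++_ a b
      eq = trans n (trans m c)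
      φ₁ = φ (P ⊗ˢ H A) (Q ⊗ˢ H A)
      φ₂ = φ (H A ⊗ˢ P) (H A ⊗ˢ Q)
      φ₃ = φ (prefix P) (prefix Q)
      σs = σˢ P (H A) ⊕₁ σˢ Q (H A)
      ρP = ρˢ (prefix (P ++ Q))

theorem4p5 : ∀ {o ℓ e : Level} (R : RigCategory o ℓ e) →
    let open RigCategory R in
    let open Strictification R in
    (A : Obj) (P Q : Poly) →
      IsIdentityˢ (H A ⊗ˢ (P ++ Q)) ((H A ⊗ˢ P) ++ (H A ⊗ˢ Q)) (δˡˢ (H A) P Q)
theorem4p5 R A = StrictificationProperties.OneLetter.δˡˢ-one-letter R A
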